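{- Let $G$ be a graph with a twin cover $K$ of size $k$, let $\varphi$ be an $\mathsf{MSO}_1$ sentence with $q_v$ element quantifiers and $q_S$ set quantifiers, and suppose every clique of $G\setminus K$ (connected component of $G\setminus K$) has at most $2^{q_S}q_v$ vertices. Then either there exists a clique $C$ of $G\setminus K$ such that $G\models\varphi$ if and only if $G\setminus C\models\varphi$, or the number of vertices of $G$ is at most \[k+(q_v+1)q_v^2\,2^{k+2q_S+2^{q_S}q_Sq_v}=2^{O(k+2^{q_S}q_Sq_v)}.\]
   Context: All graphs are finite, simple and undirected; $N(v)$ is the neighborhood of $v$. An edge $\{u,v\}$ is a twin-edge if $N(u)\setminus\{v\}=N(v)\setminus\{u\}$; a twin cover of $G$ is a set $K\subseteq V(G)$ such that every edge not a twin-edge has an endpoint in $K$; hence every connected component of $G\setminus K$ is a clique. $\mathsf{MSO}_1$ is monadic second-order logic over graphs with quantification over vertices and vertex sets. $G\setminus C$ denotes deletion of the vertices of $C$. -}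

module Defs where

open import Data.Nat using (ℕ; zero; suc)
open import Data.Nat.Base using (_+_)
open import Data.Bool using (Bool; true; false; _∧_; _∨_; not)
open import Data.Fin using (Fin)
open import Data.Fin.Properties using (_≟_)
open import Data.Fin.Subset using (Subset; _∈_; _∉_; Nonempty; ⊤; ∁)
open import Data.Vec using (Vec; []; _∷_; lookup)
open import Data.List using (List; []; _∷_; map; _++_; allFin)
open import Data.Bool.ListAction using (any; all)
open import Data.Product using (_×_)
open import Data.Sum using (_⊎_)
open import Relation.Nullary.Decidable using (⌊_⌋)
open import Relation.Binary.PropositionalEquality using (_≡_; _≢_)

record Graph (n : ℕ) : Set where
  field
    E      : Fin n → Fin n → Bool
    sym    : ∀ u v → E u v ≡ E v u
    irrefl : ∀ v → E v v ≡ false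
open Graph public

TwinEdge : ∀ {n} → Graph n → Fin n → Fin n → Set
TwinEdge G u v = (E G u v ≡ true) × (∀ w → w ≢ u → w ≢ v → E G u w ≡ E G v w)

IsTwinCover : ∀ {n} → Graph n → Subset n → Set
IsTwinCover G K = ∀ u v → E G u v ≡ true → (u ∈ K ⊎ v ∈ K) ⊎ TwinEdge G u v

-- C is a clique of G ∖ K, i.e. a connected component of G ∖ K (which is
-- a clique): nonempty, disjoint from K, pairwise adjacent, and closed under
-- adjacency inside G ∖ K.
IsCliqueOf : ∀ {n} → Graph n → Subset n → Subset n → Set
IsCliqueOf G K C =
  Nonempty C
  × (∀ v → v ∈ C → v ∉ K)
  × (∀ u v → u ∈ C → v ∈ C → u ≢ v → E G u v ≡ true)
  × (∀ u v → u ∈ C → v ∉ K → E G u v ≡ true → v ∈ C)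

-- MSO₁ syntax: de Bruijn indices, i element variables and j set variables

data Formula (i j : ℕ) : Set where
  _≐_  : Fin i → Fin i → Formula i j
  adj  : Fin i → Fin i → Formula i j
  _∈̇_  : Fin i → Fin j → Formula i j
  ¬̇_   : Formula i j → Formula i j
  _∧̇_  : Formula i j → Formula i j → Formula i j
  _∨̇_  : Formula i j → Formula i j → Formula i j
  ∃v   : Formula (suc i) j → Formula i j
  ∀v   : Formula (suc i) j → Formula i j
  ∃S   : Formula i (suc j) → Formula i j
  ∀S   : Formula i (suc j) → Formula i j

Sentence : Set
Sentence = Formula 0 0

#elemQ : ∀ {i j} → Formula i j → ℕ
#elemQ (x ≐ y)   = 0
#elemQ (adj x y) = 0
#elemQ (x ∈̇ X)   = 0
#elemQ (¬̇ φ)     = #elemQ φ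
#elemQ (φ ∧̇ ψ)   = #elemQ φ + #elemQ ψ
#elemQ (φ ∨̇ ψ)   = #elemQ φ + #elemQ ψ
#elemQ (∃v φ)    = suc (#elemQ φ)
#elemQ (∀v φ)    = suc (#elemQ φ)
#elemQ (∃S φ)    = #elemQ φ
#elemQ (∀S φ)    = #elemQ φ

#setQ : ∀ {i j} → Formula i j → ℕ
#setQ (x ≐ y)   = 0
#setQ (adj x y) = 0
#setQ (x ∈̇ X)   = 0
#setQ (¬̇ φ)     = #setQ φ
#setQ (φ ∧̇ ψ)   = #setQ φ + #setQ ψ
#setQ (φ ∨̇ ψ)   = #setQ φ + #setQ ψ
#setQ (∃v φ)    = #setQ φ
#setQ (∀v φ)    = #setQ φ
#setQ (∃S φ)    = suc (#setQ φ)
#setQ (∀S φ)    = suc (#setQ φ)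

-- Semantics (classical, Boolean-valued; all domains are finite).
-- eval G U φ ρ σ evaluates φ in the induced subgraph G[U]: element
-- quantifiers range over vertices in U, set quantifiers over subsets of U.

allSubsets : (n : ℕ) → List (Subset n)
allSubsets zero    = [] ∷ []
allSubsets (suc n) = map (true ∷_) (allSubsets n) ++ map (false ∷_) (allSubsets n)

_⊆ᵇ_ : ∀ {n} → Subset n → Subset n → Bool
_⊆ᵇ_ {n} S U = all (λ v → not (lookup S v) ∨ lookup U v) (allFin n)

eval : ∀ {n i j} → Graph n → Subset n → Formula i j
     → Vec (Fin n) i → Vec (Subset n) j → Bool
eval G U (x ≐ y)   ρ σ = ⌊ lookup ρ x ≟ lookup ρ y ⌋
eval G U (adj x y) ρ σ = E G (lookup ρ x) (lookup ρ y)
eval G U (x ∈̇ X)   ρ σ = lookup (lookup σ X) (lookup ρ x)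
eval G U (¬̇ φ)     ρ σ = not (eval G U φ ρ σ)
eval G U (φ ∧̇ ψ)   ρ σ = eval G U φ ρ σ ∧ eval G U ψ ρ σ
eval G U (φ ∨̇ ψ)   ρ σ = eval G U φ ρ σ ∨ eval G U ψ ρ σ
eval {n} G U (∃v φ) ρ σ = any (λ v → lookup U v ∧ eval G U φ (v ∷ ρ) σ) (allFin n)
eval {n} G U (∀v φ) ρ σ = all (λ v → not (lookup U v) ∨ eval G U φ (v ∷ ρ) σ) (allFin n)
eval {n} G U (∃S φ) ρ σ = any (λ S → (S ⊆ᵇ U) ∧ eval G U φ ρ (S ∷ σ)) (allSubsets n)
eval {n} G U (∀S φ) ρ σ = all (λ S → not (S ⊆ᵇ U) ∨ eval G U φ ρ (S ∷ σ)) (allSubsets n)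

_⊨_ : ∀ {n} → Graph n → Sentence → Bool
G ⊨ φ = eval G ⊤ φ [] []

_∖_⊨_ : ∀ {n} → Graph n → Subset n → Sentence → Bool
G ∖ C ⊨ φ = eval G (∁ C) φ [] []

-- Outside the twin cover K every vertex lies in a clique, and two disjoint such cliques of the
-- same size with the same neighbourhood in K are exchanged by an involutive automorphism of G.
-- If G exceeds the bound, pigeonholing the vertices outside K by (neighbourhood in K, clique
-- size) yields T + 1 pairwise disjoint interchangeable cliques C, C₁, …, C_T, where
-- T = (q_v + 1) 2^{M q_S} and M = 2^{q_S} q_v. Deleting C does not change the truth of φ, by a
-- back-and-forth argument between G and G ∖ C: a vertex of C is answered by its image under the
-- swap with a copy C_i that is still untouched, and a set S is answered after sorting the copies
-- by the trace of S on them, keeping those with the most frequent trace and giving C that trace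
-- as well (by a swap in one direction, by pasting in the other). An element quantifier uses up
-- one copy and a set quantifier keeps at least a 2^{-s} fraction of them, so T copies suffice.

module Submission where

open import Defs hiding (sym)

open import Data.Bool using (Bool; true; false; _∧_; _∨_; not)
import Data.Bool as Bool
open import Data.Bool.ListAction using (any; all)
open import Data.Bool.Properties using (T-≡)
open import Data.Empty using (⊥-elim)
open import Data.Fin using (Fin; zero; suc)
open import Data.Fin.Properties using (_≟_)
open import Data.Fin.Subset using (Subset; _∈_; _∉_; _⊆_; _∩_; _─_; ∣_∣; Nonempty; ⊤; ∁)
open import Data.Fin.Subset.Properties
  using (_∈?_; drop-∷-⊆; ⊆-antisym; p⊆q⇒∣p∣≤∣q∣; p─q⊆p; x∈p∩q⁺; x∈p∩q⁻; ∣p∩q∣≤∣q∣; x∈p∧x∉q⇒x∈p─q;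
         x∉p⇒x∈∁p; x∈∁p⇒x∉p; ∣∁p∣≡n∸∣p∣)
open import Data.List using (List; []; _∷_; map; _++_; allFin; length; filter; cartesianProduct; applyUpTo)
open import Data.List.Properties using (length-++; length-map; length-applyUpTo; filter-all)
open import Data.List.Membership.Propositional using (find; lose) renaming (_∈_ to _∈ˡ_)
open import Data.List.Membership.Propositional.Properties
  using (∈-++⁺ˡ; ∈-++⁺ʳ; ∈-map⁺; ∈-allFin; ∈-filter⁻; ∈-applyUpTo⁺; ∈-cartesianProduct⁺)
open import Data.List.Relation.Unary.Any using (here; there)
import Data.List.Relation.Unary.Any.Properties as Anyₚ
open import Data.List.Relation.Unary.All as All using (All; []; _∷_)
import Data.List.Relation.Unary.All.Properties as Allₚ
open import Data.List.Relation.Unary.AllPairs using (AllPairs; []; _∷_)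
import Data.List.Relation.Unary.AllPairs.Properties as AllPairsₚ
import Data.Nat as ℕ
open import Data.Nat
  using (ℕ; zero; suc; pred; _+_; _*_; _^_; _∸_; _≤_; _<_; z≤n; s≤s; z<s; _≤?_; _<?_; NonZero; >-nonZero)
open import Data.Nat.Properties
  using (+-identityʳ; +-suc; +-comm; *-suc; *-zeroʳ; *-comm; *-assoc; ^-distribˡ-+-*; ^-*-assoc;
         m≤m+n; m≤n+m; +-monoˡ-≤; +-monoˡ-<; *-mono-≤; *-monoˡ-≤; ^-monoʳ-≤; m^n≢0; m^n>0;
         ≤-reflexive; ≤-trans; <-≤-trans; ≤-<-trans; ≤-pred; m≤n⇒m≤1+n; ≮⇒≥; <⇒≱; ≤⇒≯; ≰⇒>; n≮0;
         +-cancelˡ-<; suc-injective; suc-pred; m+n∸m≡n; ∸-monoˡ-<; module ≤-Reasoning)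
open import Data.Nat.Tactic.RingSolver using (solve-∀)
open import Data.Product using (Σ; ∃-syntax; _×_; _,_; proj₁; proj₂; map₂) renaming (map to ×-map)
open import Data.Product.Properties using () renaming (≡-dec to ×-≡-dec)
open import Data.Sum using (_⊎_; inj₁; inj₂)
open import Data.Vec using (Vec; []; _∷_; lookup; tabulate; here; there)
open import Data.Vec.Properties
  using ([]=⇒lookup; lookup⇒[]=; lookup∘tabulate; tabulate∘lookup; tabulate-cong; lookup-replicate; ≡-dec)
open import Function using (_∘_; Equivalence; case_of_)
open import Relation.Nullary using (¬_; yes; no; does)
open import Relation.Nullary.Decidable using (⌊_⌋; ¬?; dec-true; _⊎-dec_; _×-dec_)
open import Relation.Unary using (Decidable)
open import Relation.Binary.Definitions using (DecidableEquality; Symmetric)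
open import Relation.Binary.PropositionalEquality

private variable A : Set

≡true-ext : ∀ {b c : Bool} → (b ≡ true → c ≡ true) → (c ≡ true → b ≡ true) → b ≡ c
≡true-ext {false} {false} _ _ = refl
≡true-ext {false} {true}  _ g = g refl
≡true-ext {true}  {false} f _ = sym (f refl)
≡true-ext {true}  {true}  _ _ = refl

∧≡true⁻ : ∀ {b c} → b ∧ c ≡ true → b ≡ true × c ≡ true
∧≡true⁻ {true} {true} _ = refl , refl

⇒≡true : ∀ {b c} → (b ≡ true → c ≡ true) → not b ∨ c ≡ true
⇒≡true {false} _ = refl
⇒≡true {true}  f = f refl

⇒≡true⁻ : ∀ {b c} → not b ∨ c ≡ true → b ≡ true → c ≡ true
⇒≡true⁻ {true} e _ = e

any≡true⁻ : ∀ (p : A → Bool) xs → any p xs ≡ true → ∃[ a ] a ∈ˡ xs × p a ≡ true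
any≡true⁻ p xs e with find (Anyₚ.any⁻ p xs (Equivalence.from T-≡ e))
... | a , a∈xs , pa = a , a∈xs , Equivalence.to T-≡ pa

any≡true⁺ : ∀ (p : A → Bool) {xs a} → a ∈ˡ xs → p a ≡ true → any p xs ≡ true
any≡true⁺ p a∈xs pa = Equivalence.to T-≡ (Anyₚ.any⁺ p (lose a∈xs (Equivalence.from T-≡ pa)))

all≡true⁻ : ∀ (p : A → Bool) xs → all p xs ≡ true → ∀ {a} → a ∈ˡ xs → p a ≡ true
all≡true⁻ p xs e a∈xs = Equivalence.to T-≡ (All.lookup (Allₚ.all⁺ p xs (Equivalence.from T-≡ e)) a∈xs)

all≡true⁺ : ∀ (p : A → Bool) xs → (∀ {a} → a ∈ˡ xs → p a ≡ true) → all p xs ≡ true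
all≡true⁺ p xs h = Equivalence.to T-≡ (Allₚ.all⁻ p (All.tabulate (Equivalence.from T-≡ ∘ h)))

record BackAndForth (uL uR fL fR : A → Bool) : Set where
  field
    forth : ∀ a → uL a ≡ true → ∃[ b ] uR b ≡ true × fL a ≡ fR b
    back  : ∀ b → uR b ≡ true → ∃[ a ] uL a ≡ true × fL a ≡ fR b

module _ (xs : List A) (complete : ∀ a → a ∈ˡ xs) {uL uR fL fR : A → Bool}
         (bf : BackAndForth uL uR fL fR) where
  open BackAndForth bf

  any-backAndForth : any (λ a → uL a ∧ fL a) xs ≡ any (λ b → uR b ∧ fR b) xs
  any-backAndForth = ≡true-ext to from
    where
    to : any (λ a → uL a ∧ fL a) xs ≡ true → any (λ b → uR b ∧ fR b) xs ≡ true
    to e with any≡true⁻ _ xs e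
    ... | a , _ , ua∧fa with ∧≡true⁻ {uL a} ua∧fa
    ... | ua , fa with forth a ua
    ... | b , ub , fa≡fb = any≡true⁺ _ (complete b) (cong₂ _∧_ ub (trans (sym fa≡fb) fa))
    from : any (λ b → uR b ∧ fR b) xs ≡ true → any (λ a → uL a ∧ fL a) xs ≡ true
    from e with any≡true⁻ _ xs e
    ... | b , _ , ub∧fb with ∧≡true⁻ {uR b} ub∧fb
    ... | ub , fb with back b ub
    ... | a , ua , fa≡fb = any≡true⁺ _ (complete a) (cong₂ _∧_ ua (trans fa≡fb fb))

  all-backAndForth : all (λ a → not (uL a) ∨ fL a) xs ≡ all (λ b → not (uR b) ∨ fR b) xs
  all-backAndForth = ≡true-ext
    (λ e → all≡true⁺ _ xs λ {b} _ → ⇒≡true λ ub → holds-right b e (back b ub))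
    (λ e → all≡true⁺ _ xs λ {a} _ → ⇒≡true λ ua → holds-left a e (forth a ua))
    where
    holds-right : ∀ b → all (λ a → not (uL a) ∨ fL a) xs ≡ true
              → ∃[ a ] uL a ≡ true × fL a ≡ fR b → fR b ≡ true
    holds-right b e (a , ua , fa≡fb) = trans (sym fa≡fb) (⇒≡true⁻ (all≡true⁻ _ xs e (complete a)) ua)
    holds-left : ∀ a → all (λ b → not (uR b) ∨ fR b) xs ≡ true
               → ∃[ b ] uR b ≡ true × fL a ≡ fR b → fL a ≡ true
    holds-left a e (b , ub , fa≡fb) = trans fa≡fb (⇒≡true⁻ (all≡true⁻ _ xs e (complete b)) ub)

∈-allSubsets : ∀ {n} (S : Subset n) → S ∈ˡ allSubsets n
∈-allSubsets []          = here refl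
∈-allSubsets (true ∷ S)  = ∈-++⁺ˡ (∈-map⁺ (true ∷_) (∈-allSubsets S))
∈-allSubsets {suc n} (false ∷ S) =
  ∈-++⁺ʳ (map (true ∷_) (allSubsets n)) (∈-map⁺ (false ∷_) (∈-allSubsets S))

length-allSubsets : ∀ n → length (allSubsets n) ≡ 2 ^ n
length-allSubsets zero    = refl
length-allSubsets (suc n) = begin
  length (map (true ∷_) (allSubsets n) ++ map (false ∷_) (allSubsets n))
    ≡⟨ length-++ (map (true ∷_) (allSubsets n)) ⟩
  length (map (true ∷_) (allSubsets n)) + length (map (false ∷_) (allSubsets n))
    ≡⟨ cong₂ _+_ (length-map _ (allSubsets n)) (length-map _ (allSubsets n)) ⟩
  length (allSubsets n) + length (allSubsets n)
    ≡⟨ cong₂ _+_ (length-allSubsets n) (trans (length-allSubsets n) (sym (+-identityʳ _))) ⟩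
  2 ^ suc n ∎
  where open ≡-Reasoning

⊆ᵇ-sound : ∀ {n} (S U : Subset n) → S ⊆ᵇ U ≡ true → ∀ x → lookup S x ≡ true → lookup U x ≡ true
⊆ᵇ-sound {n} S U e x = ⇒≡true⁻ (all≡true⁻ _ (allFin n) e (∈-allFin x))

⊆ᵇ-complete : ∀ {n} (S U : Subset n) → (∀ x → lookup S x ≡ true → lookup U x ≡ true) → S ⊆ᵇ U ≡ true
⊆ᵇ-complete {n} S U h = all≡true⁺ _ (allFin n) λ {x} _ → ⇒≡true (h x)

-- Invariance of MSO₁ under automorphisms

module Automorphism {n} (G : Graph n) (π : Fin n → Fin n)
  (π-involutive : ∀ x → π (π x) ≡ x) (π-preserves-E : ∀ u v → E G (π u) (π v) ≡ E G u v) where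

  π-injective : ∀ {a b} → π a ≡ π b → a ≡ b
  π-injective {a} {b} e = trans (sym (π-involutive a)) (trans (cong π e) (π-involutive b))

  ≟-π : ∀ a b → ⌊ a ≟ b ⌋ ≡ ⌊ π a ≟ π b ⌋
  ≟-π a b with a ≟ b | π a ≟ π b
  ... | yes _    | yes _ = refl
  ... | no _     | no _  = refl
  ... | yes refl | no πa≢πb = ⊥-elim (πa≢πb refl)
  ... | no a≢b   | yes πa≡πb = ⊥-elim (a≢b (π-injective πa≡πb))

  Transports : Subset n → Subset n → Set
  Transports S S′ = ∀ x → lookup S′ (π x) ≡ lookup S x

  image : Subset n → Subset n
  image S = tabulate (lookup S ∘ π)

  transports-image : ∀ S → Transports S (image S)
  transports-image S x = trans (lookup∘tabulate _ (π x)) (cong (lookup S) (π-involutive x))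

  image-transports : ∀ T → Transports (image T) T
  image-transports T x = sym (lookup∘tabulate _ x)

  module _ {U U′ : Subset n} (U↦U′ : Transports U U′) where

    eval-π : ∀ {i j} {ρ ρ′ : Vec (Fin n) i} {σ σ′ : Vec (Subset n) j} (φ : Formula i j)
           → (∀ k → lookup ρ′ k ≡ π (lookup ρ k))
           → (∀ X → Transports (lookup σ X) (lookup σ′ X))
           → eval G U φ ρ σ ≡ eval G U′ φ ρ′ σ′

    vertex-backAndForth : ∀ {i j} {ρ ρ′ : Vec (Fin n) i} {σ σ′ : Vec (Subset n) j}
      (φ : Formula (suc i) j) → (∀ k → lookup ρ′ k ≡ π (lookup ρ k))
      → (∀ X → Transports (lookup σ X) (lookup σ′ X))
      → BackAndForth (lookup U) (lookup U′) (λ a → eval G U φ (a ∷ ρ) σ) (λ b → eval G U′ φ (b ∷ ρ′) σ′)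
    vertex-backAndForth {ρ = ρ} {ρ′} φ ρ↦ρ′ σ↦σ′ = record
      { forth = λ a a∈U → π a , trans (U↦U′ a) a∈U , eval-π φ (extend refl) σ↦σ′
      ; back  = λ b b∈U′ → π b
                         , trans (sym (U↦U′ (π b))) (trans (cong (lookup U′) (π-involutive b)) b∈U′)
                         , eval-π φ (extend (sym (π-involutive b))) σ↦σ′ }
      where
      extend : ∀ {a b} → b ≡ π a → ∀ k → lookup (b ∷ ρ′) k ≡ π (lookup (a ∷ ρ) k)
      extend b≡πa zero    = b≡πa
      extend _    (suc k) = ρ↦ρ′ k

    set-backAndForth : ∀ {i j} {ρ ρ′ : Vec (Fin n) i} {σ σ′ : Vec (Subset n) j}
      (φ : Formula i (suc j)) → (∀ k → lookup ρ′ k ≡ π (lookup ρ k))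
      → (∀ X → Transports (lookup σ X) (lookup σ′ X))
      → BackAndForth (_⊆ᵇ U) (_⊆ᵇ U′) (λ S → eval G U φ ρ (S ∷ σ)) (λ T → eval G U′ φ ρ′ (T ∷ σ′))
    set-backAndForth {σ = σ} {σ′} φ ρ↦ρ′ σ↦σ′ = record
      { forth = λ S S⊆U → image S , ⊆ᵇ-complete (image S) U′ (image⊆U′ S (⊆ᵇ-sound S U S⊆U))
                        , eval-π φ ρ↦ρ′ (extend (transports-image S))
      ; back  = λ T T⊆U′ → image T , ⊆ᵇ-complete (image T) U (image⊆U T (⊆ᵇ-sound T U′ T⊆U′))
                         , eval-π φ ρ↦ρ′ (extend (image-transports T)) }
      where
      extend : ∀ {S T} → Transports S T → ∀ X → Transports (lookup (S ∷ σ) X) (lookup (T ∷ σ′) X)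
      extend S↦T zero    = S↦T
      extend _   (suc X) = σ↦σ′ X
      image⊆U′ : ∀ S → (∀ x → lookup S x ≡ true → lookup U x ≡ true)
               → ∀ y → lookup (image S) y ≡ true → lookup U′ y ≡ true
      image⊆U′ S S⊆U y y∈πS = begin
        lookup U′ y         ≡⟨ cong (lookup U′) (π-involutive y) ⟨
        lookup U′ (π (π y)) ≡⟨ U↦U′ (π y) ⟩
        lookup U (π y)      ≡⟨ S⊆U (π y) (trans (sym (lookup∘tabulate _ y)) y∈πS) ⟩
        true                ∎
        where open ≡-Reasoning
      image⊆U : ∀ T → (∀ x → lookup T x ≡ true → lookup U′ x ≡ true)
              → ∀ y → lookup (image T) y ≡ true → lookup U y ≡ true
      image⊆U T T⊆U′ y y∈πT =
        trans (sym (U↦U′ y)) (T⊆U′ (π y) (trans (sym (lookup∘tabulate _ y)) y∈πT))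

    eval-π (x ≐ y)   ρ↦ρ′ σ↦σ′ rewrite ρ↦ρ′ x | ρ↦ρ′ y = ≟-π _ _
    eval-π (adj x y) ρ↦ρ′ σ↦σ′ rewrite ρ↦ρ′ x | ρ↦ρ′ y = sym (π-preserves-E _ _)
    eval-π {ρ = ρ} (x ∈̇ X) ρ↦ρ′ σ↦σ′ rewrite ρ↦ρ′ x = sym (σ↦σ′ X (lookup ρ x))
    eval-π (¬̇ φ)     ρ↦ρ′ σ↦σ′ = cong not (eval-π φ ρ↦ρ′ σ↦σ′)
    eval-π (φ ∧̇ ψ)   ρ↦ρ′ σ↦σ′ = cong₂ _∧_ (eval-π φ ρ↦ρ′ σ↦σ′) (eval-π ψ ρ↦ρ′ σ↦σ′)
    eval-π (φ ∨̇ ψ)   ρ↦ρ′ σ↦σ′ = cong₂ _∨_ (eval-π φ ρ↦ρ′ σ↦σ′) (eval-π ψ ρ↦ρ′ σ↦σ′)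
    eval-π (∃v φ)    ρ↦ρ′ σ↦σ′ = any-backAndForth (allFin n) ∈-allFin (vertex-backAndForth φ ρ↦ρ′ σ↦σ′)
    eval-π (∀v φ)    ρ↦ρ′ σ↦σ′ = all-backAndForth (allFin n) ∈-allFin (vertex-backAndForth φ ρ↦ρ′ σ↦σ′)
    eval-π (∃S φ)    ρ↦ρ′ σ↦σ′ = any-backAndForth (allSubsets n) ∈-allSubsets (set-backAndForth φ ρ↦ρ′ σ↦σ′)
    eval-π (∀S φ)    ρ↦ρ′ σ↦σ′ = all-backAndForth (allSubsets n) ∈-allSubsets (set-backAndForth φ ρ↦ρ′ σ↦σ′)

-- Counting and the pigeonhole principle

subsetsOf : ∀ {n} → Subset n → List (Subset n)
subsetsOf []          = [] ∷ []
subsetsOf (true ∷ K)  = map (true ∷_) (subsetsOf K) ++ map (false ∷_) (subsetsOf K)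
subsetsOf (false ∷ K) = map (false ∷_) (subsetsOf K)

length-subsetsOf : ∀ {n} (K : Subset n) → length (subsetsOf K) ≡ 2 ^ ∣ K ∣
length-subsetsOf []          = refl
length-subsetsOf (true ∷ K)  = begin
  length (map (true ∷_) (subsetsOf K) ++ map (false ∷_) (subsetsOf K))
    ≡⟨ length-++ (map (true ∷_) (subsetsOf K)) ⟩
  length (map (true ∷_) (subsetsOf K)) + length (map (false ∷_) (subsetsOf K))
    ≡⟨ cong₂ _+_ (length-map _ (subsetsOf K)) (length-map _ (subsetsOf K)) ⟩
  length (subsetsOf K) + length (subsetsOf K)
    ≡⟨ cong₂ _+_ (length-subsetsOf K) (trans (length-subsetsOf K) (sym (+-identityʳ _))) ⟩
  2 ^ suc ∣ K ∣ ∎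
  where open ≡-Reasoning
length-subsetsOf (false ∷ K) = trans (length-map _ (subsetsOf K)) (length-subsetsOf K)

∈-subsetsOf : ∀ {n} {N K : Subset n} → N ⊆ K → N ∈ˡ subsetsOf K
∈-subsetsOf {N = []}      {[]}        _   = here refl
∈-subsetsOf {N = true ∷ N}  {true ∷ K}  N⊆K = ∈-++⁺ˡ (∈-map⁺ (true ∷_) (∈-subsetsOf (drop-∷-⊆ N⊆K)))
∈-subsetsOf {N = false ∷ N} {true ∷ K}  N⊆K =
  ∈-++⁺ʳ (map (true ∷_) (subsetsOf K)) (∈-map⁺ (false ∷_) (∈-subsetsOf (drop-∷-⊆ N⊆K)))
∈-subsetsOf {N = false ∷ N} {false ∷ K} N⊆K = ∈-map⁺ (false ∷_) (∈-subsetsOf (drop-∷-⊆ N⊆K))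
∈-subsetsOf {N = true ∷ N}  {false ∷ K} N⊆K with N⊆K here
... | ()

length-cartesianProduct : ∀ {B : Set} (xs : List A) (ys : List B)
                        → length (cartesianProduct xs ys) ≡ length xs * length ys
length-cartesianProduct []       ys = refl
length-cartesianProduct (x ∷ xs) ys = begin
  length (map (x ,_) ys ++ cartesianProduct xs ys)       ≡⟨ length-++ (map (x ,_) ys) ⟩
  length (map (x ,_) ys) + length (cartesianProduct xs ys)
    ≡⟨ cong₂ _+_ (length-map _ ys) (length-cartesianProduct xs ys) ⟩
  length ys + length xs * length ys                      ∎
  where open ≡-Reasoning

length-filter-¬ : ∀ {P : A → Set} (P? : Decidable P) xs
                → length xs ≡ length (filter P? xs) + length (filter (¬? ∘ P?) xs)
length-filter-¬ P? []       = refl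
length-filter-¬ P? (x ∷ xs) with does (P? x)
... | true  = cong suc (length-filter-¬ P? xs)
... | false = trans (cong suc (length-filter-¬ P? xs)) (sym (+-suc _ _))

length-filter-filter : ∀ {P Q : A → Set} (P? : Decidable P) (Q? : Decidable Q) xs
                     → length (filter P? (filter Q? xs)) ≤ length (filter P? xs)
length-filter-filter P? Q? []       = z≤n
length-filter-filter P? Q? (x ∷ xs) with does (Q? x)
... | true with does (P? x)
...   | true  = s≤s (length-filter-filter P? Q? xs)
...   | false = length-filter-filter P? Q? xs
length-filter-filter P? Q? (x ∷ xs) | false with does (P? x)
...   | true  = m≤n⇒m≤1+n (length-filter-filter P? Q? xs)
...   | false = length-filter-filter P? Q? xs

length-filter-mono : ∀ {P Q : A → Set} (P? : Decidable P) (Q? : Decidable Q) {xs}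
                   → All (λ x → P x → Q x) xs → length (filter P? xs) ≤ length (filter Q? xs)
length-filter-mono P? Q? {[]}     []           = z≤n
length-filter-mono P? Q? {x ∷ xs} (P⇒Q ∷ P⇒Qs) with P? x | Q? x
... | yes _  | yes _  = s≤s (length-filter-mono P? Q? P⇒Qs)
... | yes Px | no ¬Qx = ⊥-elim (¬Qx (P⇒Q Px))
... | no _   | yes _  = m≤n⇒m≤1+n (length-filter-mono P? Q? P⇒Qs)
... | no _   | no _   = length-filter-mono P? Q? P⇒Qs

length-filter-except : ∀ {R : A → A → Set} {P Q : A → Set} (P? : Decidable P) (Q? : Decidable Q)
  → Symmetric R → ∀ {xs a} → AllPairs R xs → a ∈ˡ xs → (∀ {b} → R a b → P b → Q b)
  → length (filter P? xs) ≤ suc (length (filter Q? xs))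
length-filter-except P? Q? R-sym {a ∷ ys} (Ra ∷ _) (here refl) P⇒Q
  with mono ← length-filter-mono P? Q? (All.map P⇒Q Ra) | does (P? a) | does (Q? a)
... | true  | true  = s≤s (m≤n⇒m≤1+n mono)
... | true  | false = s≤s mono
... | false | true  = m≤n⇒m≤1+n (m≤n⇒m≤1+n mono)
... | false | false = m≤n⇒m≤1+n mono
length-filter-except P? Q? R-sym {x ∷ ys} (Rx ∷ Rys) (there a∈ys) P⇒Q
  with IH ← length-filter-except P? Q? R-sym Rys a∈ys P⇒Q | P? x | Q? x
... | yes _  | yes _  = s≤s IH
... | yes Px | no ¬Qx = ⊥-elim (¬Qx (P⇒Q (R-sym (All.lookup Rx a∈ys)) Px))
... | no _   | yes _  = m≤n⇒m≤1+n IH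
... | no _   | no _   = IH

length>0⇒∈ : ∀ {xs : List A} → 0 < length xs → ∃[ x ] x ∈ˡ xs
length>0⇒∈ {xs = x ∷ _} _ = x , here refl

more-than-c*k-remain : ∀ {c k a b m} → c * suc k < m → m ≤ a + b → ¬ c < a → c * k < b
more-than-c*k-remain {c} {k} {a} {b} {m} lt m≤a+b c≮a = +-cancelˡ-< c (c * k) b (begin-strict
  c + c * k ≡⟨ *-suc c k ⟨
  c * suc k <⟨ lt ⟩
  m         ≤⟨ m≤a+b ⟩
  a + b     ≤⟨ +-monoˡ-≤ b (≮⇒≥ c≮a) ⟩
  c + b     ∎)
  where open ≤-Reasoning

module _ {K : Set} (_≟ᴷ_ : DecidableEquality K) {A : Set} (key : A → K) where

  pigeonhole : ∀ ks (L : List A) → All (λ a → key a ∈ˡ ks) L → ∀ c → c * length ks < length L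
             → ∃[ κ ] c < length (filter (λ a → key a ≟ᴷ κ) L)
  pigeonhole []       []      []      c lt = ⊥-elim (n≮0 (subst (_< 0) (*-zeroʳ c) lt))
  pigeonhole (κ ∷ ks) L keys c lt with c <? length (filter (λ a → key a ≟ᴷ κ) L)
  ... | yes c<|class| = κ , c<|class|
  ... | no  c≮|class| =
    map₂ (λ c<|class′| → <-≤-trans c<|class′| (length-filter-filter _ _ L))
         (pigeonhole ks L′ keys′ c (more-than-c*k-remain lt (≤-reflexive (length-filter-¬ _ L)) c≮|class|))
    where
    L′ = filter (λ a → ¬? (key a ≟ᴷ κ)) L
    drop-κ : ∀ {a} → key a ∈ˡ κ ∷ ks × key a ≢ κ → key a ∈ˡ ks
    drop-κ (here ka≡κ  , ka≢κ) = ⊥-elim (ka≢κ ka≡κ)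
    drop-κ (there ka∈ks , _)   = ka∈ks
    keys′ : All (λ a → key a ∈ˡ ks) L′
    keys′ = All.map drop-κ (All.zip (Allₚ.filter⁺ _ keys , Allₚ.all-filter _ L))

∣p∣≡∣p∩q∣+∣p─q∣ : ∀ {n} (p q : Subset n) → ∣ p ∣ ≡ ∣ p ∩ q ∣ + ∣ p ─ q ∣
∣p∣≡∣p∩q∣+∣p─q∣ []          []          = refl
∣p∣≡∣p∩q∣+∣p─q∣ (true ∷ p)  (true ∷ q)  = cong suc (∣p∣≡∣p∩q∣+∣p─q∣ p q)
∣p∣≡∣p∩q∣+∣p─q∣ (true ∷ p)  (false ∷ q) = trans (cong suc (∣p∣≡∣p∩q∣+∣p─q∣ p q)) (sym (+-suc _ _))
∣p∣≡∣p∩q∣+∣p─q∣ (false ∷ p) (true ∷ q)  = ∣p∣≡∣p∩q∣+∣p─q∣ p q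
∣p∣≡∣p∩q∣+∣p─q∣ (false ∷ p) (false ∷ q) = ∣p∣≡∣p∩q∣+∣p─q∣ p q

x∈p─q⇒x∉q : ∀ {n} {p q : Subset n} {x} → x ∈ p ─ q → x ∉ q
x∈p─q⇒x∉q {p = _ ∷ p} {true ∷ q}  (there x∈p─q) (there x∈q) = x∈p─q⇒x∉q x∈p─q x∈q
x∈p─q⇒x∉q {p = _ ∷ p} {false ∷ q} (there x∈p─q) (there x∈q) = x∈p─q⇒x∉q x∈p─q x∈q

∣p∣>0⇒Nonempty : ∀ {n} (p : Subset n) → 0 < ∣ p ∣ → Nonempty p
∣p∣>0⇒Nonempty (true ∷ p)  _   = zero , here
∣p∣>0⇒Nonempty (false ∷ p) ∣p∣>0 with ∣p∣>0⇒Nonempty p ∣p∣>0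
... | x , x∈p = suc x , there x∈p

satisfying : ∀ {n} {P : Fin n → Set} → Decidable P → Subset n
satisfying P? = tabulate (does ∘ P?)

∈-satisfying⁺ : ∀ {n} {P : Fin n → Set} (P? : Decidable P) {x} → P x → x ∈ satisfying P?
∈-satisfying⁺ P? {x} Px = lookup⇒[]= x _ (trans (lookup∘tabulate _ x) (dec-true (P? x) Px))

∈-satisfying⁻ : ∀ {n} {P : Fin n → Set} (P? : Decidable P) {x} → x ∈ satisfying P? → P x
∈-satisfying⁻ P? {x} x∈ with P? x | trans (sym (lookup∘tabulate (does ∘ P?) x)) ([]=⇒lookup x∈)
... | yes Px | _ = Px
... | no _   | ()

lookup⊤ : ∀ {n} (x : Fin n) → lookup ⊤ x ≡ true
lookup⊤ x = lookup-replicate x true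

lookup-─-∉ : ∀ {n} (p q : Subset n) {x} → x ∉ q → lookup (p ─ q) x ≡ lookup p x
lookup-─-∉ (b ∷ p) (true ∷ q)  {zero}  x∉q = ⊥-elim (x∉q here)
lookup-─-∉ (b ∷ p) (false ∷ q) {zero}  x∉q = refl
lookup-─-∉ (b ∷ p) (_ ∷ q)     {suc x} x∉q = lookup-─-∉ p q (x∉q ∘ there)

∈⇒∣p∣>0 : ∀ {n} {p : Subset n} {x} → x ∈ p → 0 < ∣ p ∣
∈⇒∣p∣>0 {p = true ∷ p} here       = z<s
∈⇒∣p∣>0 {p = true ∷ p} (there _)  = z<s
∈⇒∣p∣>0 {p = false ∷ p} (there m) = ∈⇒∣p∣>0 m

lookup∁≡true⁺ : ∀ {n} {p : Subset n} {x} → x ∉ p → lookup (∁ p) x ≡ true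
lookup∁≡true⁺ x∉p = []=⇒lookup (x∉p⇒x∈∁p x∉p)

lookup∁≡true⁻ : ∀ {n} (p : Subset n) {x} → lookup (∁ p) x ≡ true → x ∉ p
lookup∁≡true⁻ p {x} e = x∈∁p⇒x∉p (lookup⇒[]= x (∁ p) e)

∣p∣+x<n⇒x<∣∁p∣ : ∀ {n} (p : Subset n) {x} → ∣ p ∣ + x < n → x < ∣ ∁ p ∣
∣p∣+x<n⇒x<∣∁p∣ {n} p {x} ∣p∣+x<n = begin-strict
  x                 ≡⟨ m+n∸m≡n ∣ p ∣ x ⟨
  ∣ p ∣ + x ∸ ∣ p ∣ <⟨ ∸-monoˡ-< ∣p∣+x<n (m≤m+n ∣ p ∣ x) ⟩
  n ∸ ∣ p ∣         ≡⟨ ∣∁p∣≡n∸∣p∣ p ⟨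
  ∣ ∁ p ∣           ∎
  where open ≤-Reasoning

∉⇒lookup≡false : ∀ {n} {p : Subset n} {x} → x ∉ p → lookup p x ≡ false
∉⇒lookup≡false {p = p} {x} x∉p with lookup p x in e
... | true  = ⊥-elim (x∉p (lookup⇒[]= x p e))
... | false = refl

module _ {K : Set} (_≟ᴷ_ : DecidableEquality K) {n} (key : Fin n → K) where

  fiber : K → Subset n
  fiber κ = satisfying (λ x → key x ≟ᴷ κ)

  pigeonhole-subset : ∀ ks (W : Subset n) → (∀ {x} → x ∈ W → key x ∈ˡ ks) → ∀ c → c * length ks < ∣ W ∣
                    → ∃[ κ ] c < ∣ W ∩ fiber κ ∣
  pigeonhole-subset [] W keys c lt with keys (proj₂ (∣p∣>0⇒Nonempty W (<-≤-trans (s≤s z≤n) lt)))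
  ... | ()
  pigeonhole-subset (κ ∷ ks) W keys c lt with c <? ∣ W ∩ fiber κ ∣
  ... | yes c<|class| = κ , c<|class|
  ... | no  c≮|class| =
    map₂ (λ c<|class′| → <-≤-trans c<|class′| (p⊆q⇒∣p∣≤∣q∣ W′∩⊆W∩))
         (pigeonhole-subset ks W′ keys′ c
           (more-than-c*k-remain lt (≤-reflexive (∣p∣≡∣p∩q∣+∣p─q∣ W (fiber κ))) c≮|class|))
    where
    W′ = W ─ fiber κ
    keys′ : ∀ {x} → x ∈ W′ → key x ∈ˡ ks
    keys′ {x} x∈W′ with keys (p─q⊆p W (fiber κ) x∈W′)
    ... | here kx≡κ   = ⊥-elim (x∈p─q⇒x∉q x∈W′ (∈-satisfying⁺ (λ y → key y ≟ᴷ κ) kx≡κ))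
    ... | there kx∈ks = kx∈ks
    W′∩⊆W∩ : ∀ {κ′} → W′ ∩ fiber κ′ ⊆ W ∩ fiber κ′
    W′∩⊆W∩ x∈ with x∈p∩q⁻ W′ _ x∈
    ... | x∈W′ , x∈class = x∈p∩q⁺ (p─q⊆p W (fiber κ) x∈W′ , x∈class)

-- Enumerated sets and the automorphism swapping two of them

record Enumeration {n} (p : Subset n) (s : ℕ) : Set where
  field
    at       : Fin s → Fin n
    at∈      : ∀ i → at i ∈ p
    index    : ∀ {x} → x ∈ p → Fin s
    at-index : ∀ {x} (x∈p : x ∈ p) → at (index x∈p) ≡ x
    index-at : ∀ {i} (at-i∈p : at i ∈ p) → index at-i∈p ≡ i

  at-injective : ∀ {i j} → at i ≡ at j → i ≡ j
  at-injective {i} e =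
    trans (sym (index-at (at∈ i))) (trans (index-subst e (at∈ i)) (index-at (subst (_∈ p) e (at∈ i))))
    where
    index-subst : ∀ {x y} (x≡y : x ≡ y) (x∈p : x ∈ p) → index x∈p ≡ index (subst (_∈ p) x≡y x∈p)
    index-subst refl _ = refl

nth : ∀ {n} (p : Subset n) → Fin ∣ p ∣ → Fin n
nth (true ∷ p)  zero    = zero
nth (true ∷ p)  (suc i) = suc (nth p i)
nth (false ∷ p) i       = suc (nth p i)

rank : ∀ {n} {p : Subset n} {x} → x ∈ p → Fin ∣ p ∣
rank {p = true ∷ p}  here      = zero
rank {p = true ∷ p}  (there m) = suc (rank m)
rank {p = false ∷ p} (there m) = rank m

nth∈ : ∀ {n} (p : Subset n) i → nth p i ∈ p
nth∈ (true ∷ p)  zero    = here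
nth∈ (true ∷ p)  (suc i) = there (nth∈ p i)
nth∈ (false ∷ p) i       = there (nth∈ p i)

nth-rank : ∀ {n} {p : Subset n} {x} (x∈p : x ∈ p) → nth p (rank x∈p) ≡ x
nth-rank {p = true ∷ p}  here      = refl
nth-rank {p = true ∷ p}  (there m) = cong suc (nth-rank m)
nth-rank {p = false ∷ p} (there m) = cong suc (nth-rank m)

rank-nth : ∀ {n} (p : Subset n) i (m : nth p i ∈ p) → rank m ≡ i
rank-nth (true ∷ p)  zero    here      = refl
rank-nth (true ∷ p)  (suc i) (there m) = cong suc (rank-nth p i m)
rank-nth (false ∷ p) i       (there m) = rank-nth p i m

enumerate : ∀ {n} (p : Subset n) {s} → ∣ p ∣ ≡ s → Enumeration p s
enumerate p refl = record
  { at = nth p ; at∈ = nth∈ p ; index = rank ; at-index = nth-rank ; index-at = rank-nth p _ }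

data Region {n s} {C S : Subset n} (eC : Enumeration C s) (eS : Enumeration S s) (x : Fin n) : Set where
  in₁     : ∀ i → x ≡ Enumeration.at eC i → Region eC eS x
  in₂     : ∀ i → x ≡ Enumeration.at eS i → Region eC eS x
  outside : x ∉ C → x ∉ S → Region eC eS x

region : ∀ {n s} {C S : Subset n} (eC : Enumeration C s) (eS : Enumeration S s) x → Region eC eS x
region {C = C} {S} eC eS x with x ∈? C | x ∈? S
... | yes x∈C | _       = in₁ _ (sym (Enumeration.at-index eC x∈C))
... | no _    | yes x∈S = in₂ _ (sym (Enumeration.at-index eS x∈S))
... | no x∉C  | no x∉S  = outside x∉C x∉S

module Swap {n} (G : Graph n) {C S : Subset n} {s} (eC : Enumeration C s) (eS : Enumeration S s)
  (S∩C≡∅ : ∀ {x} → x ∈ S → x ∉ C)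
  (E-within  : ∀ i j → E G (Enumeration.at eC i) (Enumeration.at eC j)
                     ≡ E G (Enumeration.at eS i) (Enumeration.at eS j))
  (E-across  : ∀ i j → E G (Enumeration.at eC i) (Enumeration.at eS j) ≡ false)
  (E-outside : ∀ i {y} → y ∉ C → y ∉ S → E G (Enumeration.at eC i) y ≡ E G (Enumeration.at eS i) y)
  where

  open Enumeration eC using () renaming (at to atC; at∈ to atC∈; index to indexC; index-at to indexC-at)
  open Enumeration eS using () renaming (at to atS; at∈ to atS∈; index to indexS; index-at to indexS-at)

  swap : Fin n → Fin n
  swap x with x ∈? C | x ∈? S
  ... | yes x∈C | _       = atS (indexC x∈C)
  ... | no _    | yes x∈S = atC (indexS x∈S)
  ... | no _    | no _    = x

  swap-C : ∀ i → swap (atC i) ≡ atS i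
  swap-C i with atC i ∈? C | atC i ∈? S
  ... | yes m | _ = cong atS (indexC-at m)
  ... | no ∉C | _ = ⊥-elim (∉C (atC∈ i))

  swap-S : ∀ i → swap (atS i) ≡ atC i
  swap-S i with atS i ∈? C | atS i ∈? S
  ... | yes ∈C | _     = ⊥-elim (S∩C≡∅ (atS∈ i) ∈C)
  ... | no _   | yes m = cong atC (indexS-at m)
  ... | no _   | no ∉S = ⊥-elim (∉S (atS∈ i))

  swap-fixes : ∀ {x} → x ∉ C → x ∉ S → swap x ≡ x
  swap-fixes {x} x∉C x∉S with x ∈? C | x ∈? S
  ... | yes x∈C | _       = ⊥-elim (x∉C x∈C)
  ... | no _    | yes x∈S = ⊥-elim (x∉S x∈S)
  ... | no _    | no _    = refl

  swap-involutive : ∀ x → swap (swap x) ≡ x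
  swap-involutive x with region eC eS x
  ... | in₁ i refl       = trans (cong swap (swap-C i)) (swap-S i)
  ... | in₂ i refl       = trans (cong swap (swap-S i)) (swap-C i)
  ... | outside x∉C x∉S   = trans (cong swap (swap-fixes x∉C x∉S)) (swap-fixes x∉C x∉S)

  swap-preserves-E : ∀ u v → E G (swap u) (swap v) ≡ E G u v
  swap-preserves-E u v = go (region eC eS u) (region eC eS v)
    where
    E-sym = Graph.sym G
    go : Region eC eS u → Region eC eS v → E G (swap u) (swap v) ≡ E G u v
    go (in₁ i refl) (in₁ j refl) rewrite swap-C i | swap-C j = sym (E-within i j)
    go (in₁ i refl) (in₂ j refl) rewrite swap-C i | swap-S j =
      trans (E-sym _ _) (trans (E-across j i) (sym (E-across i j)))
    go (in₁ i refl) (outside v∉C v∉S) rewrite swap-C i | swap-fixes v∉C v∉S = sym (E-outside i v∉C v∉S)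
    go (in₂ i refl) (in₁ j refl) rewrite swap-S i | swap-C j =
      trans (E-across i j) (sym (trans (E-sym _ _) (E-across j i)))
    go (in₂ i refl) (in₂ j refl) rewrite swap-S i | swap-S j = E-within i j
    go (in₂ i refl) (outside v∉C v∉S) rewrite swap-S i | swap-fixes v∉C v∉S = E-outside i v∉C v∉S
    go (outside u∉C u∉S) (in₁ j refl) rewrite swap-fixes u∉C u∉S | swap-C j =
      trans (E-sym _ _) (trans (sym (E-outside j u∉C u∉S)) (E-sym _ _))
    go (outside u∉C u∉S) (in₂ j refl) rewrite swap-fixes u∉C u∉S | swap-S j =
      trans (E-sym _ _) (trans (E-outside j u∉C u∉S) (E-sym _ _))
    go (outside u∉C u∉S) (outside v∉C v∉S) rewrite swap-fixes u∉C u∉S | swap-fixes v∉C v∉S = refl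

-- Cliques outside a twin cover

module TwinCover {n} (G : Graph n) {K : Subset n} (K-twinCover : IsTwinCover G K) where

  adjacent⇒≢ : ∀ {u v} → E G u v ≡ true → v ≢ u
  adjacent⇒≢ {u} uv refl = case trans (sym uv) (irrefl G u) of λ ()

  twins : ∀ {a b} → a ∉ K → b ∉ K → E G a b ≡ true → ∀ {w} → w ≢ a → w ≢ b → E G a w ≡ E G b w
  twins a∉K b∉K ab w≢a w≢b with K-twinCover _ _ ab
  ... | inj₁ (inj₁ a∈K) = ⊥-elim (a∉K a∈K)
  ... | inj₁ (inj₂ b∈K) = ⊥-elim (b∉K b∈K)
  ... | inj₂ (_ , same) = same _ w≢a w≢b

  InClique : Fin n → Fin n → Set
  InClique x u = u ≡ x ⊎ (u ∉ K × E G x u ≡ true)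

  inClique? : ∀ x → Decidable (InClique x)
  inClique? x u = (u ≟ x) ⊎-dec (¬? (u ∈? K) ×-dec (E G x u Bool.≟ true))

  clique : Fin n → Subset n
  clique x = satisfying (inClique? x)

  x∈clique : ∀ x → x ∈ clique x
  x∈clique x = ∈-satisfying⁺ (inClique? x) (inj₁ refl)

  module _ {x} (x∉K : x ∉ K) where

    clique⊆∁K : ∀ {u} → u ∈ clique x → u ∉ K
    clique⊆∁K u∈ with ∈-satisfying⁻ (inClique? x) u∈
    ... | inj₁ refl        = x∉K
    ... | inj₂ (u∉K , _)   = u∉K

    clique-adjacent : ∀ {u v} → u ∈ clique x → v ∈ clique x → u ≢ v → E G u v ≡ true
    clique-adjacent u∈ v∈ u≢v with ∈-satisfying⁻ (inClique? x) u∈ | ∈-satisfying⁻ (inClique? x) v∈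
    ... | inj₁ refl        | inj₁ refl        = ⊥-elim (u≢v refl)
    ... | inj₁ refl        | inj₂ (_ , xv)    = xv
    ... | inj₂ (_ , xu)    | inj₁ refl        = trans (Graph.sym G _ _) xu
    ... | inj₂ (u∉K , xu)  | inj₂ (_ , xv)    =
      trans (sym (twins x∉K u∉K xu (adjacent⇒≢ xv) (u≢v ∘ sym))) xv

    clique-closed : ∀ {u v} → u ∈ clique x → v ∉ K → E G u v ≡ true → v ∈ clique x
    clique-closed {v = v} u∈ v∉K uv with ∈-satisfying⁻ (inClique? x) u∈
    ... | inj₁ refl = ∈-satisfying⁺ (inClique? x) (inj₂ (v∉K , uv))
    ... | inj₂ (u∉K , xu) with v ≟ x
    ...   | yes refl = x∈clique x
    ...   | no v≢x   =
      ∈-satisfying⁺ (inClique? x) (inj₂ (v∉K , trans (twins x∉K u∉K xu v≢x (adjacent⇒≢ uv)) uv))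

    clique-isCliqueOf : IsCliqueOf G K (clique x)
    clique-isCliqueOf = (x , x∈clique x) , (λ _ → clique⊆∁K) , (λ _ _ → clique-adjacent)
                      , (λ _ _ u∈ v∉K uv → clique-closed u∈ v∉K uv)

    clique-nonadjacent : ∀ {u y} → u ∈ clique x → y ∉ K → y ∉ clique x → E G u y ≡ false
    clique-nonadjacent {u} {y} u∈ y∉K y∉ with E G u y in uy
    ... | false = refl
    ... | true  = ⊥-elim (y∉ (clique-closed u∈ y∉K uy))

    E-toK : ∀ {u y} → u ∈ clique x → y ∈ K → E G u y ≡ E G x y
    E-toK u∈ y∈K with ∈-satisfying⁻ (inClique? x) u∈
    ... | inj₁ refl       = refl
    ... | inj₂ (u∉K , xu) = sym (twins x∉K u∉K xu (λ { refl → x∉K y∈K }) (λ { refl → u∉K y∈K }))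

  clique⊆clique : ∀ {x y z} → x ∉ K → y ∉ K → z ∈ clique x → z ∈ clique y → clique x ⊆ clique y
  clique⊆clique {x} {y} {z} x∉K y∉K z∈x z∈y {u} u∈x with u ≟ z
  ... | yes refl = z∈y
  ... | no u≢z   = clique-closed y∉K z∈y (clique⊆∁K x∉K u∈x) (clique-adjacent x∉K z∈x u∈x (u≢z ∘ sym))

  clique-of-member : ∀ {x u} → x ∉ K → u ∈ clique x → clique u ≡ clique x
  clique-of-member x∉K u∈x = ⊆-antisym (clique⊆clique u∉K x∉K (x∈clique _) u∈x)
                                        (clique⊆clique x∉K u∉K u∈x (x∈clique _))
    where u∉K = clique⊆∁K x∉K u∈x

  nbhdK : Fin n → Subset n
  nbhdK x = tabulate (λ y → lookup K y ∧ E G x y)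

  lookup-nbhdK : ∀ x {y} → y ∈ K → lookup (nbhdK x) y ≡ E G x y
  lookup-nbhdK x {y} y∈K rewrite lookup∘tabulate (λ y → lookup K y ∧ E G x y) y | []=⇒lookup y∈K = refl

  nbhdK-of-member : ∀ {x u} → x ∉ K → u ∈ clique x → nbhdK u ≡ nbhdK x
  nbhdK-of-member {x} {u} x∉K u∈x = tabulate-cong same
    where
    same : ∀ y → (lookup K y ∧ E G u y) ≡ (lookup K y ∧ E G x y)
    same y with y ∈? K
    ... | yes y∈K = cong (lookup K y ∧_) (E-toK x∉K u∈x y∈K)
    ... | no y∉K  rewrite ∉⇒lookup≡false y∉K = refl

  module SwapCliques {a b} (a∉K : a ∉ K) (b∉K : b ∉ K) (same-nbhdK : nbhdK a ≡ nbhdK b)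
    (b∩a≡∅ : ∀ {x} → x ∈ clique b → x ∉ clique a) {s}
    (ea : Enumeration (clique a) s) (eb : Enumeration (clique b) s) where

    open Enumeration ea using () renaming (at to atA; at∈ to atA∈; at-injective to atA-injective)
    open Enumeration eb using () renaming (at to atB; at∈ to atB∈; at-injective to atB-injective)

    E-within : ∀ i j → E G (atA i) (atA j) ≡ E G (atB i) (atB j)
    E-within i j with i ≟ j
    ... | yes refl = trans (irrefl G _) (sym (irrefl G _))
    ... | no i≢j   = trans (clique-adjacent a∉K (atA∈ i) (atA∈ j) (i≢j ∘ atA-injective))
                           (sym (clique-adjacent b∉K (atB∈ i) (atB∈ j) (i≢j ∘ atB-injective)))

    E-across : ∀ i j → E G (atA i) (atB j) ≡ false
    E-across i j = clique-nonadjacent a∉K (atA∈ i) (clique⊆∁K b∉K (atB∈ j)) (b∩a≡∅ (atB∈ j))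

    E-outside : ∀ i {y} → y ∉ clique a → y ∉ clique b → E G (atA i) y ≡ E G (atB i) y
    E-outside i {y} y∉a y∉b with y ∈? K
    ... | yes y∈K = begin
      E G (atA i) y         ≡⟨ E-toK a∉K (atA∈ i) y∈K ⟩
      E G a y               ≡⟨ lookup-nbhdK a y∈K ⟨
      lookup (nbhdK a) y    ≡⟨ cong (λ N → lookup N y) same-nbhdK ⟩
      lookup (nbhdK b) y    ≡⟨ lookup-nbhdK b y∈K ⟩
      E G b y               ≡⟨ E-toK b∉K (atB∈ i) y∈K ⟨
      E G (atB i) y         ∎
      where open ≡-Reasoning
    ... | no y∉K = trans (clique-nonadjacent a∉K (atA∈ i) y∉K y∉a)
                         (sym (clique-nonadjacent b∉K (atB∈ i) y∉K y∉b))

    open Swap G ea eb b∩a≡∅ E-within E-across E-outside public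

  disjoint-cliques : ∀ {x y z} → x ∉ K → y ∉ K → y ∉ clique x → z ∈ clique y → z ∉ clique x
  disjoint-cliques x∉K y∉K y∉x z∈y z∈x = y∉x (clique⊆clique y∉K x∉K z∈y z∈x (x∈clique _))

  record Homogeneous (W N : Subset n) (s : ℕ) : Set where
    field
      W∩K≡∅  : ∀ {x} → x ∈ W → x ∉ K
      nbhdK≡ : ∀ {x} → x ∈ W → nbhdK x ≡ N
      size≡  : ∀ {x} → x ∈ W → ∣ clique x ∣ ≡ s
      closed : ∀ {x} → x ∈ W → clique x ⊆ W
  open Homogeneous

  DisjointCliques : Fin n → Fin n → Set
  DisjointCliques a b = ∀ {y} → y ∈ clique a → y ∉ clique b

  module _ {W N s} (hom : Homogeneous W N s) {x} (x∈W : x ∈ W) where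

    disjoint-from-removed : ∀ {y} → y ∈ W ─ clique x → DisjointCliques x y
    disjoint-from-removed y∈W′ z∈x z∈y = disjoint-cliques (W∩K≡∅ hom x∈W)
      (W∩K≡∅ hom (p─q⊆p W (clique x) y∈W′)) (x∈p─q⇒x∉q y∈W′) z∈y z∈x

    homogeneous-─ : Homogeneous (W ─ clique x) N s
    homogeneous-─ = record
      { W∩K≡∅  = W∩K≡∅ hom ∘ p─q⊆p W (clique x)
      ; nbhdK≡ = nbhdK≡ hom ∘ p─q⊆p W (clique x)
      ; size≡  = size≡ hom ∘ p─q⊆p W (clique x)
      ; closed = λ y∈W′ u∈y → x∈p∧x∉q⇒x∈p─q (closed hom (p─q⊆p W (clique x) y∈W′) u∈y)
                                             (λ u∈x → disjoint-from-removed y∈W′ u∈x u∈y) }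

    ∣W∩clique∣≤s : ∣ W ∩ clique x ∣ ≤ s
    ∣W∩clique∣≤s = subst (∣ W ∩ clique x ∣ ≤_) (size≡ hom x∈W) (∣p∩q∣≤∣q∣ W (clique x))

  extract-disjoint-cliques : ∀ {W N s} t → Homogeneous W N s → s * t < ∣ W ∣
    → ∃[ xs ] length xs ≡ suc t × All (_∈ W) xs × AllPairs DisjointCliques xs
  extract-disjoint-cliques {W} t hom s*t<∣W∣ with ∣p∣>0⇒Nonempty W (<-≤-trans z<s s*t<∣W∣)
  extract-disjoint-cliques zero hom _ | x , x∈W = x ∷ [] , refl , x∈W ∷ [] , [] ∷ []
  extract-disjoint-cliques {W} (suc t) hom s*t<∣W∣ | x , x∈W
    with xs , |xs| , xs⊆W′ , xs-disjoint ← extract-disjoint-cliques t (homogeneous-─ hom x∈W)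
           (more-than-c*k-remain s*t<∣W∣ (≤-reflexive (∣p∣≡∣p∩q∣+∣p─q∣ W (clique x))) (≤⇒≯ (∣W∩clique∣≤s hom x∈W)))
    = x ∷ xs , cong suc |xs| , x∈W ∷ All.map (p─q⊆p W (clique x)) xs⊆W′
    , All.map (disjoint-from-removed hom x∈W) xs⊆W′ ∷ xs-disjoint

  vertexType : Fin n → Subset n × ℕ
  vertexType x = nbhdK x , ∣ clique x ∣

  _≟ᵛ_ : DecidableEquality (Subset n × ℕ)
  _≟ᵛ_ = ×-≡-dec (≡-dec Bool._≟_) ℕ._≟_

  nbhdK⊆K : ∀ x → nbhdK x ⊆ K
  nbhdK⊆K x {y} y∈ = lookup⇒[]= y K
    (proj₁ (∧≡true⁻ (trans (sym (lookup∘tabulate (λ y → lookup K y ∧ E G x y) y)) ([]=⇒lookup y∈))))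

  ∣clique∣>0 : ∀ x → 0 < ∣ clique x ∣
  ∣clique∣>0 x = ∈⇒∣p∣>0 (x∈clique x)

  vertexTypes : ℕ → List (Subset n × ℕ)
  vertexTypes M = cartesianProduct (subsetsOf K) (applyUpTo suc M)

  length-vertexTypes : ∀ M → length (vertexTypes M) ≡ 2 ^ ∣ K ∣ * M
  length-vertexTypes M = trans (length-cartesianProduct (subsetsOf K) (applyUpTo suc M))
                               (cong₂ _*_ (length-subsetsOf K) (length-applyUpTo suc M))

  ∈-vertexTypes : ∀ {M x} → ∣ clique x ∣ ≤ M → vertexType x ∈ˡ vertexTypes M
  ∈-vertexTypes {M} {x} size≤M = ∈-cartesianProduct⁺ (∈-subsetsOf (nbhdK⊆K x)) (size∈ (∣clique∣>0 x) size≤M)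
    where
    size∈ : ∀ {m} → 0 < m → m ≤ M → m ∈ˡ applyUpTo suc M
    size∈ {suc m} _ m<M = ∈-applyUpTo⁺ suc m<M

  module _ (N : Subset n) (s : ℕ) where

    ofType : Subset n
    ofType = ∁ K ∩ fiber _≟ᵛ_ vertexType (N , s)

    ∈-ofType⁻ : ∀ {x} → x ∈ ofType → x ∉ K × vertexType x ≡ (N , s)
    ∈-ofType⁻ x∈ = ×-map x∈∁p⇒x∉p (∈-satisfying⁻ (λ y → vertexType y ≟ᵛ (N , s))) (x∈p∩q⁻ (∁ K) _ x∈)

    ofType-homogeneous : Homogeneous ofType N s
    ofType-homogeneous = record
      { W∩K≡∅  = proj₁ ∘ ∈-ofType⁻
      ; nbhdK≡ = cong proj₁ ∘ proj₂ ∘ ∈-ofType⁻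
      ; size≡  = cong proj₂ ∘ proj₂ ∘ ∈-ofType⁻
      ; closed = λ x∈ u∈x → let x∉K , type≡ = ∈-ofType⁻ x∈ in
          x∈p∩q⁺ (x∉p⇒x∈∁p (clique⊆∁K x∉K u∈x) , ∈-satisfying⁺ (λ y → vertexType y ≟ᵛ (N , s))
            (trans (cong₂ _,_ (nbhdK-of-member x∉K u∈x) (cong ∣_∣ (clique-of-member x∉K u∈x))) type≡)) }

  homogeneous-class : ∀ {M} c → (∀ {x} → x ∉ K → ∣ clique x ∣ ≤ M) → c * (2 ^ ∣ K ∣ * M) < ∣ ∁ K ∣
    → ∃[ N ] ∃[ s ] 1 ≤ s × s ≤ M × c < ∣ ofType N s ∣
  homogeneous-class {M} c size≤M c*types<∣∁K∣
    with (N , s) , c<∣W∣ ← pigeonhole-subset _≟ᵛ_ vertexType (vertexTypes M) (∁ K)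
                             (λ x∈∁K → ∈-vertexTypes (size≤M (x∈∁p⇒x∉p x∈∁K))) c
                             (subst (λ m → c * m < ∣ ∁ K ∣) (sym (length-vertexTypes M)) c*types<∣∁K∣)
    with x , x∈W ← ∣p∣>0⇒Nonempty (ofType N s) (<-≤-trans z<s c<∣W∣)
    = N , s , subst (1 ≤_) (size≡ (ofType-homogeneous N s) x∈W) (∣clique∣>0 x)
            , subst (_≤ M) (size≡ (ofType-homogeneous N s) x∈W) (size≤M (proj₁ (∈-ofType⁻ N s x∈W)))
            , c<∣W∣

-- Deleting a clique that has enough interchangeable copies

module CliqueDeletion {n} (G : Graph n) {C : Subset n} {s} (1≤s : 1 ≤ s) (eC : Enumeration C s) where

  open Enumeration eC using ()
    renaming (at to atC; at∈ to atC∈; index to indexC; at-index to atC-index; index-at to indexC-at)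

  record Copy : Set where
    field
      set              : Subset n
      enum             : Enumeration set s
      set∩C≡∅          : ∀ {x} → x ∈ set → x ∉ C
      swap             : Fin n → Fin n
      swap-involutive  : ∀ x → swap (swap x) ≡ x
      swap-preserves-E : ∀ u v → E G (swap u) (swap v) ≡ E G u v
      swap-C           : ∀ i → swap (atC i) ≡ Enumeration.at enum i
      swap-fixes       : ∀ {x} → x ∉ C → x ∉ set → swap x ≡ x

    open Enumeration enum public using (at; at∈)

    swap-copy : ∀ i → swap (at i) ≡ atC i
    swap-copy i = trans (cong swap (sym (swap-C i))) (swap-involutive (atC i))

  open Copy

  Disjoint : Copy → Copy → Set
  Disjoint e e′ = ∀ {x} → x ∈ set e → x ∉ set e′

  Disjoint-sym : Symmetric Disjoint
  Disjoint-sym e∩e′≡∅ x∈e′ x∈e = e∩e′≡∅ x∈e x∈e′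

  trace : Subset n → Copy → Vec Bool s
  trace T e = tabulate (λ i → lookup T (at e i))

  traceC : Subset n → Vec Bool s
  traceC T = tabulate (λ i → lookup T (atC i))

  _≟ᵗ_ : DecidableEquality (Vec Bool s)
  _≟ᵗ_ = ≡-dec Bool._≟_

  agreeing : Subset n → List Copy → List Copy
  agreeing T = filter (λ e → trace T e ≟ᵗ traceC T)

  lookup-trace : ∀ {T e} → trace T e ≡ traceC T → ∀ i → lookup T (at e i) ≡ lookup T (atC i)
  lookup-trace same i =
    trans (sym (lookup∘tabulate _ i)) (trans (cong (λ t → lookup t i) same) (lookup∘tabulate _ i))

  swap-preserves-set : ∀ (e : Copy) T → trace T e ≡ traceC T → ∀ x → lookup T (swap e x) ≡ lookup T x
  swap-preserves-set e T same x with region eC (enum e) x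
  ... | in₁ i refl         = trans (cong (lookup T) (swap-C e i)) (lookup-trace {T} {e} same i)
  ... | in₂ i refl         = trans (cong (lookup T) (swap-copy e i)) (sym (lookup-trace {T} {e} same i))
  ... | outside x∉C x∉set = cong (lookup T) (swap-fixes e x∉C x∉set)

  record Fresh {i j} (ρ : Vec (Fin n) i) (σ : Vec (Subset n) j) (e : Copy) : Set where
    field
      ρ∉copy   : ∀ k → lookup ρ k ∉ set e
      σ-traces : ∀ X → trace (lookup σ X) e ≡ traceC (lookup σ X)
  open Fresh

  -- ρ, σ are assignments in G and ρ, σ′ in G ∖ C; the copies are the cliques still free to
  -- stand in for C.
  record Position {i j} (ρ : Vec (Fin n) i) (σ σ′ : Vec (Subset n) j) (copies : List Copy) : Set where
    field
      ρ∉C             : ∀ k → lookup ρ k ∉ C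
      σ′≈σ            : ∀ X {x} → x ∉ C → lookup (lookup σ′ X) x ≡ lookup (lookup σ X) x
      copies-disjoint : AllPairs Disjoint copies
      copies-fresh    : All (Fresh ρ σ) copies
  open Position

  -- The number of cliques, C included, that φ needs: an element quantifier uses up one copy and
  -- a set quantifier keeps the copies carrying one of the 2^s possible traces.
  budget : ∀ {i j} → Formula i j → ℕ
  budget φ = (2 ^ s) ^ #setQ φ * suc (#elemQ φ)

  Preserved : ∀ {i j} → Formula i j → Set
  Preserved {i} {j} φ = ∀ {ρ : Vec (Fin n) i} {σ σ′ : Vec (Subset n) j} {copies}
    → Position ρ σ σ′ copies → budget φ ≤ suc (length copies) → eval G ⊤ φ ρ σ ≡ eval G (∁ C) φ ρ σ′

  eval-swap-vertex : ∀ {i j} (φ : Formula (suc i) j) {ρ σ} (e : Copy) → (∀ k → lookup ρ k ∉ C) → Fresh ρ σ e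
                   → ∀ a → eval G ⊤ φ (a ∷ ρ) σ ≡ eval G ⊤ φ (swap e a ∷ ρ) σ
  eval-swap-vertex φ {ρ} {σ} e ρ∉C fresh a =
    eval-π (λ x → trans (lookup⊤ (swap e x)) (sym (lookup⊤ x))) φ swapped
           (λ X → swap-preserves-set e (lookup σ X) (σ-traces fresh X))
    where
    open Automorphism G (swap e) (swap-involutive e) (swap-preserves-E e)
    swapped : ∀ k → lookup (swap e a ∷ ρ) k ≡ swap e (lookup (a ∷ ρ) k)
    swapped zero    = refl
    swapped (suc k) = sym (swap-fixes e (ρ∉C k) (ρ∉copy fresh k))

  avoiding : Fin n → List Copy → List Copy
  avoiding a = filter (λ e → ¬? (a ∈? set e))

  module _ {i j} {ρ : Vec (Fin n) i} {σ σ′ : Vec (Subset n) j} where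

    fresh-∷ : ∀ {e a} → Fresh ρ σ e → a ∉ set e → Fresh (a ∷ ρ) σ e
    fresh-∷ fresh a∉e = record
      { ρ∉copy = λ { zero → a∉e ; (suc k) → ρ∉copy fresh k } ; σ-traces = σ-traces fresh }

    position-avoiding : ∀ {a cs} → a ∉ C → Position ρ σ σ′ cs → Position (a ∷ ρ) σ σ′ (avoiding a cs)
    position-avoiding {a} {cs} a∉C pos = record
      { ρ∉C             = λ { zero → a∉C ; (suc k) → ρ∉C pos k }
      ; σ′≈σ            = σ′≈σ pos
      ; copies-disjoint = AllPairsₚ.filter⁺ _ (copies-disjoint pos)
      ; copies-fresh    = All.zipWith (λ (fresh , a∉e) → fresh-∷ fresh a∉e)
                                      (Allₚ.filter⁺ _ (copies-fresh pos) , Allₚ.all-filter _ cs) }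

    position-inside : ∀ {e cs a} → Position ρ σ σ′ (e ∷ cs) → a ∈ set e → Position (a ∷ ρ) σ σ′ cs
    position-inside {e} pos a∈e with copies-disjoint pos | copies-fresh pos
    ... | e∩cs≡∅ ∷ cs-disjoint | _ ∷ cs-fresh = record
      { ρ∉C             = λ { zero → set∩C≡∅ e a∈e ; (suc k) → ρ∉C pos k }
      ; σ′≈σ            = σ′≈σ pos
      ; copies-disjoint = cs-disjoint
      ; copies-fresh    = All.zipWith (λ (fresh , e∩e′≡∅) → fresh-∷ fresh (e∩e′≡∅ a∈e)) (cs-fresh , e∩cs≡∅) }

  length≤1+avoiding : ∀ a {cs} → AllPairs Disjoint cs → length cs ≤ suc (length (avoiding a cs))
  length≤1+avoiding a {[]}     []                 = z≤n
  length≤1+avoiding a {e ∷ cs} (e∩cs≡∅ ∷ cs-disj) with a ∈? set e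
  ... | yes a∈e = s≤s (≤-reflexive (cong length (sym (filter-all _ (All.map (λ e∩e′≡∅ → e∩e′≡∅ a∈e) e∩cs≡∅)))))
  ... | no _    = s≤s (length≤1+avoiding a cs-disj)

  swap-C∈ : ∀ (e : Copy) {a} → a ∈ C → swap e a ∈ set e
  swap-C∈ e a∈C = subst (λ x → swap e x ∈ set e) (atC-index a∈C)
                        (subst (_∈ set e) (sym (swap-C e (indexC a∈C))) (at∈ e (indexC a∈C)))

  instance
    2^s≢0 : NonZero (2 ^ s)
    2^s≢0 = m^n≢0 2 s

  budget>0 : ∀ {i j} (φ : Formula i j) → 0 < budget φ
  budget>0 φ = *-mono-≤ (m^n>0 (2 ^ s) (#setQ φ)) (s≤s (z≤n {#elemQ φ}))

  vertex-backAndForth : ∀ {i j} (φ : Formula (suc i) j) → Preserved φ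
    → ∀ {ρ σ σ′ cs} → Position ρ σ σ′ cs → budget φ ≤ length cs
    → BackAndForth (lookup ⊤) (lookup (∁ C)) (λ a → eval G ⊤ φ (a ∷ ρ) σ) (λ b → eval G (∁ C) φ (b ∷ ρ) σ′)
  vertex-backAndForth φ preserved {ρ} {σ} {σ′} {cs} pos budget≤ = record
    { forth = forth
    ; back  = λ b b∈∁C → b , lookup⊤ b , via-outside (lookup∁≡true⁻ C b∈∁C) }
    where
    via-outside : ∀ {a} → a ∉ C → eval G ⊤ φ (a ∷ ρ) σ ≡ eval G (∁ C) φ (a ∷ ρ) σ′
    via-outside {a} a∉C = preserved (position-avoiding a∉C pos)
                                (≤-trans budget≤ (length≤1+avoiding a (copies-disjoint pos)))
    via-inside : ∀ {cs} → Position ρ σ σ′ cs → budget φ ≤ length cs → ∀ {a} → a ∈ C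
           → ∃[ b ] b ∉ C × eval G ⊤ φ (a ∷ ρ) σ ≡ eval G (∁ C) φ (b ∷ ρ) σ′
    via-inside {[]}     _   budget≤0 _   = ⊥-elim (<⇒≱ (budget>0 φ) budget≤0)
    via-inside {e ∷ cs} pos budget≤ {a} a∈C =
      swap e a , set∩C≡∅ e (swap-C∈ e a∈C) ,
      trans (eval-swap-vertex φ e (ρ∉C pos) (All.head (copies-fresh pos)) a)
            (preserved (position-inside pos (swap-C∈ e a∈C)) budget≤)
    forth : ∀ a → lookup ⊤ a ≡ true
          → ∃[ b ] lookup (∁ C) b ≡ true × eval G ⊤ φ (a ∷ ρ) σ ≡ eval G (∁ C) φ (b ∷ ρ) σ′
    forth a _ with a ∈? C
    ... | no a∉C  = a , lookup∁≡true⁺ a∉C , via-outside a∉C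
    ... | yes a∈C with b , b∉C , eq ← via-inside pos budget≤ a∈C = b , lookup∁≡true⁺ b∉C , eq

  eval-swap-set : ∀ {i j} (φ : Formula i (suc j)) {ρ σ} (e : Copy) → (∀ k → lookup ρ k ∉ C) → Fresh ρ σ e
                → ∀ S → eval G ⊤ φ ρ (S ∷ σ) ≡ eval G ⊤ φ ρ (tabulate (lookup S ∘ swap e) ∷ σ)
  eval-swap-set φ {ρ} {σ} e ρ∉C fresh S =
    eval-π (λ x → trans (lookup⊤ (swap e x)) (sym (lookup⊤ x))) φ
           (λ k → sym (swap-fixes e (ρ∉C k) (ρ∉copy fresh k))) transports
    where
    open Automorphism G (swap e) (swap-involutive e) (swap-preserves-E e)
    transports : ∀ X → Transports (lookup (S ∷ σ) X) (lookup (image S ∷ σ) X)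
    transports zero    = transports-image S
    transports (suc X) = swap-preserves-set e (lookup σ X) (σ-traces fresh X)

  position-set : ∀ {i j} {ρ : Vec (Fin n) i} {σ σ′ : Vec (Subset n) j} {cs T T′}
               → Position ρ σ σ′ cs → (∀ {x} → x ∉ C → lookup T′ x ≡ lookup T x)
               → Position ρ (T ∷ σ) (T′ ∷ σ′) (agreeing T cs)
  position-set {ρ = ρ} {σ} {cs = cs} {T} pos T′≈T = record
    { ρ∉C             = ρ∉C pos
    ; σ′≈σ            = λ { zero → T′≈T ; (suc X) → σ′≈σ pos X }
    ; copies-disjoint = AllPairsₚ.filter⁺ _ (copies-disjoint pos)
    ; copies-fresh    = All.zipWith extend (Allₚ.filter⁺ _ (copies-fresh pos) , Allₚ.all-filter _ cs) }
    where
    extend : ∀ {e} → Fresh ρ σ e × trace T e ≡ traceC T → Fresh ρ (T ∷ σ) e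
    extend (fresh , agrees) = record
      { ρ∉copy = ρ∉copy fresh ; σ-traces = λ { zero → agrees ; (suc X) → σ-traces fresh X } }

  pasteAt : Subset n → Vec Bool s → Fin n → Bool
  pasteAt T t x with x ∈? C
  ... | yes x∈C = lookup t (indexC x∈C)
  ... | no _    = lookup T x

  paste : Subset n → Vec Bool s → Subset n
  paste T t = tabulate (pasteAt T t)

  lookup-paste-∉ : ∀ T t {x} → x ∉ C → lookup (paste T t) x ≡ lookup T x
  lookup-paste-∉ T t {x} x∉C rewrite lookup∘tabulate (pasteAt T t) x with x ∈? C
  ... | yes x∈C = ⊥-elim (x∉C x∈C)
  ... | no _    = refl

  traceC-paste : ∀ T t → traceC (paste T t) ≡ t
  traceC-paste T t = trans (tabulate-cong at-C) (tabulate∘lookup t)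
    where
    at-C : ∀ i → lookup (paste T t) (atC i) ≡ lookup t i
    at-C i rewrite lookup∘tabulate (pasteAt T t) (atC i) with atC i ∈? C
    ... | yes m  = cong (lookup t) (indexC-at m)
    ... | no ∉C  = ⊥-elim (∉C (atC∈ i))

  trace-paste : ∀ T t e → trace (paste T t) e ≡ trace T e
  trace-paste T t e = tabulate-cong λ i → lookup-paste-∉ T t (set∩C≡∅ e (at∈ e i))

  ─C⊆ᵇ∁C : ∀ T → (T ─ C) ⊆ᵇ ∁ C ≡ true
  ─C⊆ᵇ∁C T = ⊆ᵇ-complete (T ─ C) (∁ C) λ x x∈ → lookup∁≡true⁺ (x∈p─q⇒x∉q (lookup⇒[]= x (T ─ C) x∈))

  2≤2^s : 2 ≤ 2 ^ s
  2≤2^s = ^-monoʳ-≤ 2 1≤s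

  module SetStep {i j} (φ : Formula i (suc j)) (preserved : Preserved φ)
    {ρ : Vec (Fin n) i} {σ σ′ : Vec (Subset n) j} {cs} (pos : Position ρ σ σ′ cs)
    (bound : 2 ^ s * budget φ ≤ suc (length cs)) where

    c : ℕ
    c = pred (budget φ)

    suc-c : suc c ≡ budget φ
    suc-c = suc-pred (budget φ) {{>-nonZero (budget>0 φ)}}

    c*2^s<|cs| : c * length (allSubsets s) < length cs
    c*2^s<|cs| = ≤-pred (begin
      2 + c * length (allSubsets s) ≡⟨ cong (λ k → 2 + c * k) (length-allSubsets s) ⟩
      2 + c * 2 ^ s                 ≡⟨ cong (2 +_) (*-comm c (2 ^ s)) ⟩
      2 + 2 ^ s * c                 ≤⟨ +-monoˡ-≤ (2 ^ s * c) 2≤2^s ⟩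
      2 ^ s + 2 ^ s * c             ≡⟨ *-suc (2 ^ s) c ⟨
      2 ^ s * suc c                 ≡⟨ cong (2 ^ s *_) suc-c ⟩
      2 ^ s * budget φ              ≤⟨ bound ⟩
      suc (length cs)               ∎)
      where open ≤-Reasoning

    majority : ∀ T → ∃[ t ] c < length (filter (λ e → trace T e ≟ᵗ t) cs)
    majority T = pigeonhole _≟ᵗ_ (trace T) (allSubsets s) cs (All.tabulate λ _ → ∈-allSubsets _) c c*2^s<|cs|

    -- Swapping S by a copy e* with the most frequent trace t gives C the trace t and leaves the
    -- other copies unchanged.
    forth-choice : ∀ S → ∃[ S₁ ] eval G ⊤ φ ρ (S ∷ σ) ≡ eval G ⊤ φ ρ (S₁ ∷ σ)
                             × budget φ ≤ suc (length (agreeing S₁ cs))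
    forth-choice S
      with t , c<|class| ← majority S
      with e* , e*∈class ← length>0⇒∈ {xs = filter (λ e → trace S e ≟ᵗ t) cs} (<-≤-trans z<s c<|class|)
      with e*∈cs , trace-e*≡t ← ∈-filter⁻ (λ e → trace S e ≟ᵗ t) e*∈class =
      S₁ , eval-swap-set φ e* (ρ∉C pos) (All.lookup (copies-fresh pos) e*∈cs) S , (begin
        budget φ                                    ≡⟨ suc-c ⟨
        suc c                                       ≤⟨ c<|class| ⟩
        length (filter (λ e → trace S e ≟ᵗ t) cs)
          ≤⟨ length-filter-except _ (λ e → trace S₁ e ≟ᵗ traceC S₁) (λ {e} {e′} → Disjoint-sym {e} {e′})
                                  (copies-disjoint pos) e*∈cs (λ {e} → agrees {e}) ⟩
        suc (length (agreeing S₁ cs))               ∎)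
      where
      open ≤-Reasoning
      S₁ : Subset n
      S₁ = tabulate (lookup S ∘ swap e*)
      traceC-S₁ : traceC S₁ ≡ t
      traceC-S₁ = trans (tabulate-cong λ i → trans (lookup∘tabulate _ (atC i)) (cong (lookup S) (swap-C e* i)))
                        trace-e*≡t
      trace-S₁ : ∀ {e} → Disjoint e* e → trace S₁ e ≡ trace S e
      trace-S₁ {e} e*∩e≡∅ = tabulate-cong λ i → trans (lookup∘tabulate _ (at e i))
        (cong (lookup S) (swap-fixes e* (set∩C≡∅ e (at∈ e i)) (Disjoint-sym {e*} {e} e*∩e≡∅ (at∈ e i))))
      agrees : ∀ {e} → Disjoint e* e → trace S e ≡ t → trace S₁ e ≡ traceC S₁
      agrees {e} e*∩e≡∅ trace≡t = trans (trace-S₁ {e} e*∩e≡∅) (trans trace≡t (sym traceC-S₁))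

    -- S′ avoids C, so C can be given the most frequent trace among the copies.
    back-choice : ∀ S′ → ∃[ t ] budget φ ≤ suc (length (agreeing (paste S′ t) cs))
    back-choice S′ with t , c<|class| ← majority S′ =
      t , m≤n⇒m≤1+n (begin
        budget φ                                          ≡⟨ suc-c ⟨
        suc c                                             ≤⟨ c<|class| ⟩
        length (filter (λ e → trace S′ e ≟ᵗ t) cs)
          ≤⟨ length-filter-mono _ (λ e → trace (paste S′ t) e ≟ᵗ traceC (paste S′ t)) (All.tabulate agrees) ⟩
        length (agreeing (paste S′ t) cs)                 ∎)
      where
      open ≤-Reasoning
      agrees : ∀ {e} → e ∈ˡ cs → trace S′ e ≡ t → trace (paste S′ t) e ≡ traceC (paste S′ t)
      agrees {e} _ trace≡t = trans (trace-paste S′ t e) (trans trace≡t (sym (traceC-paste S′ t)))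

    set-backAndForth : BackAndForth (_⊆ᵇ ⊤) (_⊆ᵇ ∁ C)
                         (λ S → eval G ⊤ φ ρ (S ∷ σ)) (λ S′ → eval G (∁ C) φ ρ (S′ ∷ σ′))
    set-backAndForth = record { forth = forth ; back = back }
      where
      forth : ∀ S → S ⊆ᵇ ⊤ ≡ true
            → ∃[ S′ ] S′ ⊆ᵇ ∁ C ≡ true × eval G ⊤ φ ρ (S ∷ σ) ≡ eval G (∁ C) φ ρ (S′ ∷ σ′)
      forth S _ with S₁ , eval≡ , bound₁ ← forth-choice S =
        S₁ ─ C , ─C⊆ᵇ∁C S₁ , trans eval≡ (preserved (position-set pos (lookup-─-∉ S₁ C)) bound₁)
      back : ∀ S′ → S′ ⊆ᵇ ∁ C ≡ true
           → ∃[ S ] S ⊆ᵇ ⊤ ≡ true × eval G ⊤ φ ρ (S ∷ σ) ≡ eval G (∁ C) φ ρ (S′ ∷ σ′)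
      back S′ _ with t , bound₁ ← back-choice S′ =
        paste S′ t , ⊆ᵇ-complete (paste S′ t) ⊤ (λ x _ → lookup⊤ x)
                   , preserved (position-set pos (λ x∉C → sym (lookup-paste-∉ S′ t x∉C))) bound₁

  budget-∧ˡ : ∀ {i j} (φ ψ : Formula i j) → budget φ ≤ budget (φ ∧̇ ψ)
  budget-∧ˡ φ ψ = *-mono-≤ (^-monoʳ-≤ (2 ^ s) (m≤m+n (#setQ φ) (#setQ ψ))) (s≤s (m≤m+n (#elemQ φ) (#elemQ ψ)))

  budget-∧ʳ : ∀ {i j} (φ ψ : Formula i j) → budget ψ ≤ budget (φ ∧̇ ψ)
  budget-∧ʳ φ ψ = *-mono-≤ (^-monoʳ-≤ (2 ^ s) (m≤n+m (#setQ ψ) (#setQ φ))) (s≤s (m≤n+m (#elemQ ψ) (#elemQ φ)))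

  budget-∃v : ∀ {i j} (φ : Formula (suc i) j) → budget φ < budget (∃v φ)
  budget-∃v φ = begin-strict
    budget φ                                   <⟨ +-monoˡ-< (budget φ) (m^n>0 (2 ^ s) (#setQ φ)) ⟩
    (2 ^ s) ^ #setQ φ + budget φ               ≡⟨ *-suc ((2 ^ s) ^ #setQ φ) (suc (#elemQ φ)) ⟨
    budget (∃v φ)                              ∎
    where open ≤-Reasoning

  budget-∃S : ∀ {i j} (φ : Formula i (suc j)) → budget (∃S φ) ≡ 2 ^ s * budget φ
  budget-∃S φ = *-assoc (2 ^ s) ((2 ^ s) ^ #setQ φ) (suc (#elemQ φ))

  preserved : ∀ {i j} (φ : Formula i j) → Preserved φ
  preserved (x ≐ y)   pos _ = refl
  preserved (adj x y) pos _ = refl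
  preserved (x ∈̇ X)   pos _ = sym (σ′≈σ pos X (ρ∉C pos x))
  preserved (¬̇ φ)     pos b = cong not (preserved φ pos b)
  preserved (φ ∧̇ ψ)   pos b = cong₂ _∧_ (preserved φ pos (≤-trans (budget-∧ˡ φ ψ) b))
                                         (preserved ψ pos (≤-trans (budget-∧ʳ φ ψ) b))
  preserved (φ ∨̇ ψ)   pos b = cong₂ _∨_ (preserved φ pos (≤-trans (budget-∧ˡ φ ψ) b))
                                         (preserved ψ pos (≤-trans (budget-∧ʳ φ ψ) b))
  preserved (∃v φ)    pos b = any-backAndForth (allFin n) ∈-allFin
    (vertex-backAndForth φ (preserved φ) pos (≤-pred (<-≤-trans (budget-∃v φ) b)))
  preserved (∀v φ)    pos b = all-backAndForth (allFin n) ∈-allFin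
    (vertex-backAndForth φ (preserved φ) pos (≤-pred (<-≤-trans (budget-∃v φ) b)))
  preserved (∃S φ)    pos b = any-backAndForth (allSubsets n) ∈-allSubsets
    (SetStep.set-backAndForth φ (preserved φ) pos (≤-trans (≤-reflexive (sym (budget-∃S φ))) b))
  preserved (∀S φ)    pos b = all-backAndForth (allSubsets n) ∈-allSubsets
    (SetStep.set-backAndForth φ (preserved φ) pos (≤-trans (≤-reflexive (sym (budget-∃S φ))) b))

-- The size bound

bound-identity-monomial : ∀ a q p b
  → a * q * ((q + 1) * p) * (b * (a * q)) ≡ (q + 1) * (q * (q * 1)) * (b * (a * a) * p)
bound-identity-monomial = solve-∀

bound-identity : ∀ k qv qS → let M = 2 ^ qS * qv in
  M * ((qv + 1) * 2 ^ (M * qS)) * (2 ^ k * M) ≡ (qv + 1) * qv ^ 2 * 2 ^ (k + 2 * qS + 2 ^ qS * qS * qv)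
bound-identity k qv qS = begin
  2^qS * qv * ((qv + 1) * 2^MqS) * (2^k * (2^qS * qv))  ≡⟨ bound-identity-monomial 2^qS qv 2^MqS 2^k ⟩
  (qv + 1) * qv ^ 2 * (2^k * (2^qS * 2^qS) * 2^MqS)     ≡⟨ cong ((qv + 1) * qv ^ 2 *_) powers ⟨
  (qv + 1) * qv ^ 2 * 2 ^ (k + 2 * qS + 2 ^ qS * qS * qv) ∎
  where
  open ≡-Reasoning
  2^qS = 2 ^ qS
  2^k = 2 ^ k
  2^MqS = 2 ^ (2^qS * qv * qS)
  powers : 2 ^ (k + 2 * qS + 2 ^ qS * qS * qv) ≡ 2^k * (2^qS * 2^qS) * 2^MqS
  powers = begin
    2 ^ (k + 2 * qS + 2^qS * qS * qv)          ≡⟨ ^-distribˡ-+-* 2 (k + 2 * qS) _ ⟩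
    2 ^ (k + 2 * qS) * 2 ^ (2^qS * qS * qv)
      ≡⟨ cong₂ _*_ (^-distribˡ-+-* 2 k (2 * qS)) (cong (2 ^_) (*-assoc 2^qS qS qv)) ⟩
    2^k * 2 ^ (qS + (qS + 0)) * 2 ^ (2^qS * (qS * qv))
      ≡⟨ cong₂ (λ x y → 2^k * x * 2 ^ y)
               (trans (^-distribˡ-+-* 2 qS (qS + 0)) (cong (λ z → 2^qS * 2 ^ z) (+-identityʳ qS)))
               (trans (cong (2^qS *_) (*-comm qS qv)) (sym (*-assoc 2^qS qv qS))) ⟩
    2^k * (2^qS * 2^qS) * 2^MqS ∎

cliqueBound : Sentence → ℕ
cliqueBound φ = 2 ^ #setQ φ * #elemQ φ

copyTarget : Sentence → ℕ
copyTarget φ = (#elemQ φ + 1) * 2 ^ (cliqueBound φ * #setQ φ)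

module _ {n} {G : Graph n} {K : Subset n} (K-twinCover : IsTwinCover G K) where

  open TwinCover G K-twinCover
  open Homogeneous

  module CopiesOfClique {W N s} (1≤s : 1 ≤ s) (hom : Homogeneous W N s) {a} (a∈W : a ∈ W) where

    eC : Enumeration (clique a) s
    eC = enumerate (clique a) (size≡ hom a∈W)

    open CliqueDeletion G 1≤s eC public

    Candidate : Fin n → Set
    Candidate b = b ∈ W × DisjointCliques a b

    toCopy : ∀ {b} → Candidate b → Copy
    toCopy {b} (b∈W , a∩b≡∅) = record
      { set = clique b ; enum = eb ; set∩C≡∅ = b∩a≡∅ ; swap = swap ; swap-involutive = swap-involutive
      ; swap-preserves-E = swap-preserves-E ; swap-C = swap-C ; swap-fixes = swap-fixes }
      where
      eb = enumerate (clique b) (size≡ hom b∈W)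
      b∩a≡∅ : ∀ {y} → y ∈ clique b → y ∉ clique a
      b∩a≡∅ y∈b y∈a = a∩b≡∅ y∈a y∈b
      open SwapCliques (W∩K≡∅ hom a∈W) (W∩K≡∅ hom b∈W) (trans (nbhdK≡ hom a∈W) (sym (nbhdK≡ hom b∈W)))
                       b∩a≡∅ eC eb

    toCopies : ∀ {bs} → All Candidate bs → List Copy
    toCopies []       = []
    toCopies (b ∷ bs) = toCopy b ∷ toCopies bs

    length-toCopies : ∀ {bs} (candidates : All Candidate bs) → length (toCopies candidates) ≡ length bs
    length-toCopies []               = refl
    length-toCopies (_ ∷ candidates) = cong suc (length-toCopies candidates)

    toCopies-disjoint : ∀ {bs} (candidates : All Candidate bs)
                      → AllPairs DisjointCliques bs → AllPairs Disjoint (toCopies candidates)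
    toCopies-disjoint []          []                 = []
    toCopies-disjoint (c ∷ cands) (c-disj ∷ cs-disj) = disjoint-from cands c-disj ∷ toCopies-disjoint cands cs-disj
      where
      disjoint-from : ∀ {bs} (cands : All Candidate bs) → All (DisjointCliques _) bs
                    → All (Disjoint (toCopy c)) (toCopies cands)
      disjoint-from []           []       = []
      disjoint-from (_ ∷ cands)  (d ∷ ds) = d ∷ disjoint-from cands ds

    initial-position : ∀ {bs} (candidates : All Candidate bs)
                     → AllPairs DisjointCliques bs → Position [] [] [] (toCopies candidates)
    initial-position candidates disjoint = record
      { ρ∉C = λ () ; σ′≈σ = λ () ; copies-disjoint = toCopies-disjoint candidates disjoint
      ; copies-fresh = All.tabulate (λ _ → record { ρ∉copy = λ () ; σ-traces = λ () }) }

  module _ (φ : Sentence) where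

    invariant-under-deletion : ∀ {W N s a bs} → 1 ≤ s → Homogeneous W N s
      → All (_∈ W) (a ∷ bs) → AllPairs DisjointCliques (a ∷ bs)
      → (2 ^ s) ^ #setQ φ * suc (#elemQ φ) ≤ suc (length bs) → (G ⊨ φ) ≡ (G ∖ clique a ⊨ φ)
    invariant-under-deletion 1≤s hom (a∈W ∷ bs⊆W) (a-disjoint ∷ bs-disjoint) bound =
      preserved φ (initial-position candidates bs-disjoint)
                  (subst (λ m → budget φ ≤ suc m) (sym (length-toCopies candidates)) bound)
      where
      open CopiesOfClique 1≤s hom a∈W
      candidates = All.zip (bs⊆W , a-disjoint)

    private
      M T : ℕ
      M = cliqueBound φ
      T = copyTarget φ

    budget≤T : ∀ {s} → s ≤ M → (2 ^ s) ^ #setQ φ * suc (#elemQ φ) ≤ T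
    budget≤T {s} s≤M = begin
      (2 ^ s) ^ #setQ φ * suc (#elemQ φ)    ≡⟨ cong (_* suc (#elemQ φ)) (^-*-assoc 2 s (#setQ φ)) ⟩
      2 ^ (s * #setQ φ) * suc (#elemQ φ)    ≤⟨ *-monoˡ-≤ (suc (#elemQ φ)) (^-monoʳ-≤ 2 (*-monoˡ-≤ (#setQ φ) s≤M)) ⟩
      2 ^ (M * #setQ φ) * suc (#elemQ φ)    ≡⟨ *-comm (2 ^ (M * #setQ φ)) (suc (#elemQ φ)) ⟩
      suc (#elemQ φ) * 2 ^ (M * #setQ φ)    ≡⟨ cong (_* 2 ^ (M * #setQ φ)) (+-comm 1 (#elemQ φ)) ⟩
      T                                     ∎
      where open ≤-Reasoning

    deletable-clique : (∀ C → IsCliqueOf G K C → ∣ C ∣ ≤ cliqueBound φ)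
      → cliqueBound φ * copyTarget φ * (2 ^ ∣ K ∣ * cliqueBound φ) < ∣ ∁ K ∣
      → Σ (Subset n) λ C → IsCliqueOf G K C × ((G ⊨ φ) ≡ (G ∖ C ⊨ φ))
    deletable-clique small large =
      case homogeneous-class (M * T) (λ {x} x∉K → small (clique x) (clique-isCliqueOf x∉K)) large of λ where
        (N , s , 1≤s , s≤M , MT<∣W∣) →
          case extract-disjoint-cliques T (ofType-homogeneous N s) (≤-<-trans (*-monoˡ-≤ T s≤M) MT<∣W∣) of λ where
            (a ∷ bs , |bs|≡T , a∷bs⊆W , disjoint) →
              clique a , clique-isCliqueOf (W∩K≡∅ (ofType-homogeneous N s) (All.head a∷bs⊆W)) ,
              invariant-under-deletion 1≤s (ofType-homogeneous N s) a∷bs⊆W disjoint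
                (subst (λ m → _ ≤ suc m) (sym (suc-injective |bs|≡T)) (m≤n⇒m≤1+n (budget≤T s≤M)))

proposition9 : ∀ {n} (G : Graph n) (K : Subset n) (k : ℕ)
    → IsTwinCover G K → ∣ K ∣ ≡ k
    → (φ : Sentence) (qv qS : ℕ) → #elemQ φ ≡ qv → #setQ φ ≡ qS
    → (∀ C → IsCliqueOf G K C → ∣ C ∣ ≤ 2 ^ qS * qv)
    → (Σ (Subset n) (λ C → IsCliqueOf G K C × ((G ⊨ φ) ≡ (G ∖ C ⊨ φ))))
      ⊎ (n ≤ k + (qv + 1) * qv ^ 2 * 2 ^ (k + 2 * qS + 2 ^ qS * qS * qv))
proposition9 {n} G K _ K-twinCover refl φ _ _ refl refl small
  with n ≤? ∣ K ∣ + (#elemQ φ + 1) * #elemQ φ ^ 2 * 2 ^ (∣ K ∣ + 2 * #setQ φ + 2 ^ #setQ φ * #setQ φ * #elemQ φ)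
... | yes small-graph = inj₂ small-graph
... | no  large-graph = inj₁ (deletable-clique K-twinCover φ small
  (subst (_< ∣ ∁ K ∣) (sym (bound-identity ∣ K ∣ (#elemQ φ) (#setQ φ))) (∣p∣+x<n⇒x<∣∁p∣ K (≰⇒> large-graph))))
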